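{- Let $A=\{a_1<\dots<a_m\}$ and $B=\{b_1<\dots<b_n\}$ be finite totally ordered sets, and let $x:A\to B$ and $y:B\to A$ be monotone non-decreasing maps. Let $\Gamma(x,y)$ be the digraph on vertex set $A\cup B$ with arcs $(a,x(a))$ for $a\in A$ and $(b,y(b))$ for $b\in B$. Then $\Gamma(x,y)$ contains at least one directed cycle of length $2$ and no directed cycle of length greater than $2$. -}

module Defs where

open import Data.Nat using (ℕ; zero; suc)
open import Data.Nat.DivMod using (_%_; m%n<n)
open import Data.Fin using (Fin; toℕ; fromℕ<)
open import Data.Fin using () renaming (_≤_ to _≤ᶠ_)
open import Data.Sum using (_⊎_; inj₁; inj₂)
open import Data.Product using (Σ-syntax; _×_)
open import Relation.Binary.PropositionalEquality using (_≡_)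
open import Function.Definitions using (Injective)

Monotone : ∀ {m n} → (Fin m → Fin n) → Set
Monotone {m} f = ∀ (i j : Fin m) → i ≤ᶠ j → f i ≤ᶠ f j

-- Vertex set A ∪ B (A and B are disjoint: disjoint union).
Vertex : ℕ → ℕ → Set
Vertex m n = Fin m ⊎ Fin n

Γ : ∀ {m n} → (Fin m → Fin n) → (Fin n → Fin m) → Vertex m n → Vertex m n → Set
Γ x y (inj₁ a) v = v ≡ inj₂ (x a)
Γ x y (inj₂ b) v = v ≡ inj₁ (y b)

next : ∀ {k} → Fin k → Fin k
next {suc k} i = fromℕ< (m%n<n (suc (toℕ i)) (suc k))

DirectedCycle : {V : Set} → (V → V → Set) → ℕ → Set
DirectedCycle {V} E k =
  Σ[ v ∈ (Fin k → V) ] (Injective _≡_ _≡_ v × (∀ (i : Fin k) → E (v i) (v (next i))))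

-- The arc relation of Γ(x,y) is the graph of the map σ swapping sides along
-- x and y, so a directed cycle of length k through w makes w a periodic point
-- of σ, hence a periodic point of σ², which acts as the monotone self-maps
-- y ∘ x and x ∘ y on the two sides. An orbit of a monotone self-map of a chain
-- is monotone, so it can only return to its start if it never moves: w is
-- fixed by σ², and a cycle of length > 2 would visit w again after two steps.
-- Conversely, y ∘ x has a fixed point a (descend from the top of A), and
-- a → x a → a is a 2-cycle.
module Submission where

open import Defs
open import Data.Nat using (ℕ; zero; suc; _+_; _*_; _%_; _<_; _≤_)
open import Data.Nat.Properties using (*-comm)
open import Data.Nat.DivMod using (%-distribˡ-+; m%n%n≡m%n; n%n≡0; m<n⇒m%n≡m)
open import Data.Nat.GeneralisedArithmetic using (fold; fold-+; fold-*)
open import Data.Fin as Fin using (Fin; toℕ; fromℕ; _≟_)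
open import Data.Fin.Properties using (toℕ-fromℕ<; toℕ-injective; ≤fromℕ; ≤∧≢⇒<; ≤-totalOrder)
open import Data.Fin.Induction using (<-wellFounded)
open import Data.Product using (∃-syntax; _×_; _,_)
open import Data.Sum using (inj₁; inj₂)
open import Data.Sum.Properties using (inj₁-injective; inj₂-injective)
open import Function using (_∘_)
open import Induction.WellFounded using (Acc; acc)
open import Relation.Binary.Bundles using (Poset; TotalOrder)
open import Relation.Binary.Core using (_Preserves_⟶_)
open import Relation.Nullary using (¬_; yes; no)
open import Relation.Binary.PropositionalEquality using (_≡_; _≢_; refl; sym; trans; cong; module ≡-Reasoning)
import Relation.Binary.Properties.Poset as PosetProperties

fold-periodic : ∀ {a} {A : Set a} (f : A → A) {w : A} p →
                fold w f p ≡ w → ∀ j → fold w f (j * p) ≡ w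
fold-periodic f p per zero = refl
fold-periodic f {w} p per (suc j) = begin
  fold w f (p + j * p)          ≡⟨ fold-+ w f p ⟩
  fold (fold w f (j * p)) f p   ≡⟨ cong (λ u → fold u f p) (fold-periodic f p per j) ⟩
  fold w f p                    ≡⟨ per ⟩
  w                             ∎
  where open ≡-Reasoning

fold-homo : ∀ {a b} {A : Set a} {B : Set b} (h : A → B) {f : A → A} {g : B → B} →
            (∀ u → h (f u) ≡ g (h u)) → ∀ u k → h (fold u f k) ≡ fold (h u) g k
fold-homo h homo u zero = refl
fold-homo h {f} {g} homo u (suc k) = trans (homo (fold u f k)) (cong g (fold-homo h homo u k))

module _ {c ℓ₁ ℓ₂} (P : Poset c ℓ₁ ℓ₂) where
  open Poset P using (_≈_; antisym; reflexive)
    renaming (_≤_ to _≼_; refl to ≼-refl; trans to ≼-trans)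

  inflationary-orbit : ∀ {f a} → f Preserves _≼_ ⟶ _≼_ → a ≼ f a → ∀ k → a ≼ fold a f k
  inflationary-orbit mono a≼fa zero = ≼-refl
  inflationary-orbit mono a≼fa (suc k) = ≼-trans a≼fa (mono (inflationary-orbit mono a≼fa k))

  inflationary-periodic⇒fixed : ∀ {f a} → f Preserves _≼_ ⟶ _≼_ → a ≼ f a →
                                ∀ j → fold a f (suc j) ≈ a → f a ≈ a
  inflationary-periodic⇒fixed mono a≼fa j per =
    antisym (≼-trans (mono (inflationary-orbit mono a≼fa j)) (reflexive per)) a≼fa

module _ {c ℓ₁ ℓ₂} (T : TotalOrder c ℓ₁ ℓ₂) where
  open TotalOrder T using (_≈_; total; poset) renaming (_≤_ to _≼_)

  monotone-periodic⇒fixed : ∀ {f a} → f Preserves _≼_ ⟶ _≼_ →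
                            ∀ j → fold a f (suc j) ≈ a → f a ≈ a
  monotone-periodic⇒fixed {f} {a} mono with total a (f a)
  ... | inj₁ a≼fa = inflationary-periodic⇒fixed poset mono a≼fa
  ... | inj₂ fa≼a = inflationary-periodic⇒fixed (PosetProperties.≥-poset poset) mono fa≼a

module _ {m} {f : Fin m → Fin m} (mono : Monotone f) where
  descend-to-fixedPoint : ∀ i → Acc Fin._<_ i → f i Fin.≤ i → ∃[ j ] f j ≡ j
  descend-to-fixedPoint i (acc rs) fi≤i with f i ≟ i
  ... | yes fi≡i = i , fi≡i
  ... | no fi≢i = descend-to-fixedPoint (f i) (rs (≤∧≢⇒< fi≤i fi≢i)) (mono (f i) i fi≤i)

monotone⇒fixedPoint : ∀ {m} (f : Fin (suc m) → Fin (suc m)) → Monotone f → ∃[ j ] f j ≡ j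
monotone⇒fixedPoint f mono = descend-to-fixedPoint mono (fromℕ _) (<-wellFounded _) (≤fromℕ _)

monotone-periodic⇒fixedᶠ : ∀ {m} {f : Fin m → Fin m} {a} → Monotone f →
                           ∀ j → fold a f (suc j) ≡ a → f a ≡ a
monotone-periodic⇒fixedᶠ {m} mono = monotone-periodic⇒fixed (≤-totalOrder m) (mono _ _)

Monotone-∘ : ∀ {l m n} {g : Fin m → Fin n} {f : Fin l → Fin m} →
             Monotone g → Monotone f → Monotone (g ∘ f)
Monotone-∘ mg mf i j i≤j = mg _ _ (mf i j i≤j)

toℕ-fold-next : ∀ {k} j → toℕ (fold {A = Fin (suc k)} Fin.zero next j) ≡ j % suc k
toℕ-fold-next zero = refl
toℕ-fold-next {k} (suc j) = begin
  toℕ (next (fold Fin.zero next j))     ≡⟨ toℕ-fromℕ< _ ⟩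
  suc (toℕ (fold Fin.zero next j)) % K  ≡⟨ cong (λ t → suc t % K) (toℕ-fold-next j) ⟩
  (1 + j % K) % K                       ≡⟨ %-distribˡ-+ 1 (j % K) K ⟩
  (1 % K + j % K % K) % K               ≡⟨ cong (λ t → (1 % K + t) % K) (m%n%n≡m%n j K) ⟩
  (1 % K + j % K) % K                   ≡⟨ %-distribˡ-+ 1 j K ⟨
  suc j % K                             ∎
  where
  K = suc k
  open ≡-Reasoning

module FunctionalDigraph {V : Set} (E : V → V → Set) (σ : V → V)
                         (arc⇒σ : ∀ {u w} → E u w → w ≡ σ u) where

  cycle-orbit : ∀ {k} ((c , _ , arcs) : DirectedCycle E (suc k)) →
                ∀ j → c (fold Fin.zero next j) ≡ fold (c Fin.zero) σ j
  cycle-orbit _ zero = refl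
  cycle-orbit C@(c , _ , arcs) (suc j) =
    trans (arc⇒σ (arcs (fold Fin.zero next j))) (cong σ (cycle-orbit C j))

  long-cycle⇒non-involutive-periodicPoint : ∀ k → 2 < k → DirectedCycle E k →
                                           ∃[ w ] fold w σ k ≡ w × σ (σ w) ≢ w
  long-cycle⇒non-involutive-periodicPoint (suc k) 2<k C@(c , c-injective , _) =
    c Fin.zero , returns , ¬twoStepReturn
    where
    returns : fold (c Fin.zero) σ (suc k) ≡ c Fin.zero
    returns = trans (sym (cycle-orbit C (suc k)))
                    (cong c (toℕ-injective (trans (toℕ-fold-next (suc k)) (n%n≡0 (suc k)))))
    ¬twoStepReturn : σ (σ (c Fin.zero)) ≢ c Fin.zero
    ¬twoStepReturn σ²w≡w with begin
      2                               ≡⟨ m<n⇒m%n≡m 2<k ⟨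
      2 % suc k                       ≡⟨ toℕ-fold-next 2 ⟨
      toℕ (fold Fin.zero next 2)      ≡⟨ cong toℕ (c-injective (trans (cycle-orbit C 2) σ²w≡w)) ⟩
      0                               ∎
      where open ≡-Reasoning
    ... | ()

module _ {m n} (x : Fin m → Fin n) (y : Fin n → Fin m) where

  σ : Vertex m n → Vertex m n
  σ (inj₁ a) = inj₂ (x a)
  σ (inj₂ b) = inj₁ (y b)

  Γ⇒σ : ∀ {u w} → Γ x y u w → w ≡ σ u
  Γ⇒σ {inj₁ a} arc = arc
  Γ⇒σ {inj₂ b} arc = arc

  σ-periodic⇒σ²-fixed : Monotone x → Monotone y →
                         ∀ w k → fold w σ (suc k) ≡ w → σ (σ w) ≡ w
  σ-periodic⇒σ²-fixed mx my w k per = side w σ²-per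
    where
    σ²-per : fold w (σ ∘ σ) (suc k) ≡ w
    σ²-per = begin
      fold w (σ ∘ σ) (suc k)  ≡⟨ fold-* w σ (suc k) {2} ⟨
      fold w σ (suc k * 2)    ≡⟨ cong (fold w σ) (*-comm (suc k) 2) ⟩
      fold w σ (2 * suc k)    ≡⟨ fold-periodic σ (suc k) per 2 ⟩
      w                       ∎
      where open ≡-Reasoning
    side : ∀ w → fold w (σ ∘ σ) (suc k) ≡ w → σ (σ w) ≡ w
    side (inj₁ a) per₂ = cong inj₁ (monotone-periodic⇒fixedᶠ (Monotone-∘ my mx) k
      (inj₁-injective (trans (fold-homo inj₁ {y ∘ x} {σ ∘ σ} (λ _ → refl) a (suc k)) per₂)))
    side (inj₂ b) per₂ = cong inj₂ (monotone-periodic⇒fixedᶠ (Monotone-∘ mx my) k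
      (inj₂-injective (trans (fold-homo inj₂ {x ∘ y} {σ ∘ σ} (λ _ → refl) b (suc k)) per₂)))

  fixedPoint⇒2-cycle : ∀ {a} → y (x a) ≡ a → DirectedCycle (Γ x y) 2
  fixedPoint⇒2-cycle {a} yxa≡a = c , c-injective , arcs
    where
    c : Fin 2 → Vertex m n
    c Fin.zero = inj₁ a
    c (Fin.suc Fin.zero) = inj₂ (x a)
    c-injective : ∀ {i j} → c i ≡ c j → i ≡ j
    c-injective {Fin.zero} {Fin.zero} _ = refl
    c-injective {Fin.zero} {Fin.suc Fin.zero} ()
    c-injective {Fin.suc Fin.zero} {Fin.zero} ()
    c-injective {Fin.suc Fin.zero} {Fin.suc Fin.zero} _ = refl
    arcs : ∀ i → Γ x y (c i) (c (next i))
    arcs Fin.zero = refl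
    arcs (Fin.suc Fin.zero) = cong inj₁ (sym yxa≡a)

proposition1 : (m n : ℕ) → 1 ≤ m → 1 ≤ n
    → (x : Fin m → Fin n) → (y : Fin n → Fin m)
    → Monotone x → Monotone y
    → DirectedCycle (Γ x y) 2 × (∀ (k : ℕ) → 2 < k → ¬ DirectedCycle (Γ x y) k)
proposition1 (suc m) n _ _ x y mx my = two-cycle , no-long-cycle
  where
  open FunctionalDigraph (Γ x y) (σ x y) (Γ⇒σ x y)
  two-cycle : DirectedCycle (Γ x y) 2
  two-cycle with monotone⇒fixedPoint (y ∘ x) (Monotone-∘ my mx)
  ... | _ , yxa≡a = fixedPoint⇒2-cycle x y yxa≡a
  no-long-cycle : ∀ k → 2 < k → ¬ DirectedCycle (Γ x y) k
  no-long-cycle k@(suc k′) 2<k C with long-cycle⇒non-involutive-periodicPoint k 2<k C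
  ... | w , per , σ²w≢w = σ²w≢w (σ-periodic⇒σ²-fixed x y mx my w k′ per)
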